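{- Let $n = p_1^{r_1}\cdots p_t^{r_t}$ be the prime factorization of $n$, where $t > 1$, $r_i\geq 1$, and $3 \leq p_1 < \dots < p_t$ are primes. Then the packing chromatic number of the unitary Cayley graph $G_{\mathbb{Z}_n}$ is \[ \chi_\rho(G_{\mathbb{Z}_n}) = p_1^{r_1-1} p_2^{r_2}\cdots p_t^{r_t}(p_1-1) + 1. \]
   Context: The unitary Cayley graph $G_{\mathbb{Z}_n}$ of the ring $\mathbb{Z}_n$ has vertex set $\mathbb{Z}_n$, with $x$ and $y$ adjacent if and only if $x-y$ is a unit of $\mathbb{Z}_n$ (i.e. $\gcd(x-y,n)=1$). A packing $k$-coloring of a graph $G$ is a partition of $V(G)$ into $k$ nonempty classes $V_1,\dots,V_k$ such that for each $i\in[k]$, any two distinct vertices $u,v\in V_i$ satisfy $d_G(u,v)\geq i+1$ (where $d_G$ is the shortest-path distance). The packing chromatic number $\chi_\rho(G)$ is the smallest $k$ for which $G$ admits a packing $k$-coloring. -}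

module Defs where

open import Data.Nat using (ℕ; zero; suc; _+_; _*_; _∸_; _≤_; _%_)
open import Data.Nat.Coprimality using (Coprime)
open import Data.Fin using (Fin; toℕ; zero; suc)
open import Data.Product using (Σ; _×_)
open import Relation.Nullary using (¬_)
open import Relation.Binary.PropositionalEquality using (_≡_)

-- Adjacency in the unitary Cayley graph of ℤ_n (vertices Fin n = {0,…,n-1}):
-- x ~ y iff gcd((x - y) mod n, n) = 1.
Adj : (n : ℕ) → Fin n → Fin n → Set
Adj n x y = Coprime ((toℕ x + (n ∸ toℕ y)) % suc (n ∸ 1) ) n

data Walk (n : ℕ) : Fin n → Fin n → ℕ → Set where
  here : ∀ {x} → Walk n x x 0
  step : ∀ {x y z k} → Adj n x y → Walk n y z k → Walk n x z (suc k)

DistGE : (n : ℕ) → Fin n → Fin n → ℕ → Set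
DistGE n u v m = ∀ l → suc l ≤ m → ¬ Walk n u v l

-- A packing k-coloring: c : V → Fin k, where colour index j : Fin k stands
-- for class V_{toℕ j + 1}; all classes nonempty (c surjective); two distinct
-- vertices in class V_i are at distance ≥ i + 1.
IsPackingColoring : (n k : ℕ) → (Fin n → Fin k) → Set
IsPackingColoring n k c =
  (∀ j → Σ (Fin n) (λ x → c x ≡ j)) ×
  (∀ u v → ¬ u ≡ v → c u ≡ c v → DistGE n u v (suc (suc (toℕ (c u)))))

HasPackingColoring : (n k : ℕ) → Set
HasPackingColoring n k = Σ (Fin n → Fin k) (IsPackingColoring n k)

IsPackingChromaticNumber : ℕ → ℕ → Set
IsPackingChromaticNumber n χ =
  HasPackingColoring n χ × (∀ k → HasPackingColoring n k → χ ≤ k)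

prodFin : ∀ {t} → (Fin t → ℕ) → ℕ
prodFin {zero} f = 1
prodFin {suc t} f = f zero * prodFin (λ i → f (suc i))

-- Vertices x, y of G(ℤ_n) are adjacent iff x ≢ y (mod p i) for every i. As every p i is odd,
-- any two vertices have a common neighbour, so the diameter is at most 2: in a packing colouring
-- only the first class can have more than one vertex, and that class is independent. Two distinct
-- vertices in one block of p₁ consecutive residues differ by less than every p i, hence are adjacent;
-- so an independent set has at most n / p₁ elements, a bound attained by the multiples of p₁.
-- Therefore χ_ρ = n − n / p₁ + 1.
module Submission where

open import Defs
open import Data.Nat
  using (ℕ; zero; suc; _+_; _*_; _∸_; _^_; _≤_; _<_; z≤n; s≤s; NonZero; _%_; _/_; >-nonZero⁻¹; ≢-nonZero⁻¹; nonTrivial⇒≢1)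
open import Data.Nat.Properties hiding (_≟_)
open import Data.Nat.DivMod
open import Data.Nat.Divisibility
open import Data.Nat.Coprimality using (Coprime; coprime-divisor)
open import Data.Nat.Primality using (Prime; prime⇒irreducible; prime⇒nonTrivial; prime⇒nonZero; euclidsLemma)
open import Data.Fin using (Fin; zero; suc; toℕ; fromℕ<; cast; join; splitAt; combine; remQuot; _≟_) renaming (_<_ to _<ᶠ_)
open import Data.Fin.Properties
  using (toℕ-injective; toℕ-fromℕ<; toℕ<n; toℕ-cast; cast-involutive; toℕ-combine; combine-remQuot; remQuot-combine;
         injective⇒≤; splitAt-join)
  renaming (<-cmp to <ᶠ-cmp; suc-injective to suc-injectiveᶠ)
open import Data.Product using (∃-syntax; _×_; _,_; proj₁; proj₂; uncurry)
open import Data.Sum using (_⊎_; inj₁; inj₂)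
open import Data.Sum.Properties using (inj₁-injective; inj₂-injective)
open import Data.Empty using (⊥-elim)
open import Function.Base using (_∘_)
open import Function.Bundles using (_⇔_; mk⇔; Equivalence)
open import Function.Definitions using (Injective)
open import Relation.Nullary using (¬_; yes; no; contradiction)
open import Relation.Binary.Definitions using (tri<; tri≈; tri>)
open import Relation.Binary.PropositionalEquality

module _ {d : ℕ} .{{_ : NonZero d}} where

  0%d≡0 : 0 % d ≡ 0
  0%d≡0 = m<n⇒m%n≡m (>-nonZero⁻¹ d)

  %-+-congʳ : ∀ m {n o} → n % d ≡ o % d → (m + n) % d ≡ (m + o) % d
  %-+-congʳ m {n} {o} eq = begin
    (m + n) % d             ≡⟨ %-distribˡ-+ m n d ⟩
    (m % d + n % d) % d     ≡⟨ cong (λ z → (m % d + z) % d) eq ⟩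
    (m % d + o % d) % d     ≡⟨ %-distribˡ-+ m o d ⟨
    (m + o) % d             ∎
    where open ≡-Reasoning

  -- Adding d ∸ m % d to m gives a multiple of d, which undoes the addition of m.
  [m+n]%d≡[m+o]%d⇒n%d≡o%d : ∀ m {n o} → (m + n) % d ≡ (m + o) % d → n % d ≡ o % d
  [m+n]%d≡[m+o]%d⇒n%d≡o%d m {n} {o} eq = begin
    n % d                   ≡⟨ %-remove-+ˡ n d∣k+m ⟨
    ((k + m) + n) % d       ≡⟨ cong (_% d) (+-assoc k m n) ⟩
    (k + (m + n)) % d       ≡⟨ %-+-congʳ k eq ⟩
    (k + (m + o)) % d       ≡⟨ cong (_% d) (+-assoc k m o) ⟨
    ((k + m) + o) % d       ≡⟨ %-remove-+ˡ o d∣k+m ⟩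
    o % d                   ∎
    where
    open ≡-Reasoning
    k : ℕ
    k = d ∸ m % d
    d∣k+m : d ∣ k + m
    d∣k+m = subst (d ∣_) (sym k+m≡) (∣m∣n⇒∣m+n ∣-refl (n∣m*n (m / d)))
      where
      k+m≡ : k + m ≡ d + m / d * d
      k+m≡ = begin
        k + m                       ≡⟨ cong (k +_) (m≡m%n+[m/n]*n m d) ⟩
        k + (m % d + m / d * d)     ≡⟨ +-assoc k (m % d) (m / d * d) ⟨
        k + m % d + m / d * d       ≡⟨ cong (_+ m / d * d) (m∸n+n≡m (m%n≤n m d)) ⟩
        d + m / d * d               ∎

  [m+n]%d≡n%d⇒d∣m : ∀ m n → (m + n) % d ≡ n % d → d ∣ m
  [m+n]%d≡n%d⇒d∣m m n eq = m%n≡0⇒n∣m m d (begin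
    m % d          ≡⟨ [m+n]%d≡[m+o]%d⇒n%d≡o%d n n+m≡n+0 ⟩
    0 % d          ≡⟨ 0%d≡0 ⟩
    0              ∎)
    where
    open ≡-Reasoning
    n+m≡n+0 : (n + m) % d ≡ (n + 0) % d
    n+m≡n+0 = begin
      (n + m) % d    ≡⟨ cong (_% d) (+-comm n m) ⟩
      (m + n) % d    ≡⟨ eq ⟩
      n % d          ≡⟨ cong (_% d) (+-identityʳ n) ⟨
      (n + 0) % d    ∎

  [m+n]%d≡[m+o]%d⇒n≡o : ∀ m {n o} → n < d → o < d → (m + n) % d ≡ (m + o) % d → n ≡ o
  [m+n]%d≡[m+o]%d⇒n≡o m {n} {o} n<d o<d eq = begin
    n       ≡⟨ m<n⇒m%n≡m n<d ⟨
    n % d   ≡⟨ [m+n]%d≡[m+o]%d⇒n%d≡o%d m eq ⟩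
    o % d   ≡⟨ m<n⇒m%n≡m o<d ⟩
    o       ∎
    where open ≡-Reasoning

  -- m + (n ∸ o) is the representative of m − o in ℤ_n that Adj uses.
  d∣m+[n∸o]⇔m%d≡o%d : ∀ {m n o} → d ∣ n → o ≤ n → d ∣ m + (n ∸ o) ⇔ m % d ≡ o % d
  d∣m+[n∸o]⇔m%d≡o%d {m} {n} {o} d∣n o≤n = mk⇔ to from
    where
    open ≡-Reasoning
    δ : ℕ
    δ = m + (n ∸ o)
    δ+o≡m+n : δ + o ≡ m + n
    δ+o≡m+n = trans (+-assoc m (n ∸ o) o) (cong (m +_) (m∸n+n≡m o≤n))
    to : d ∣ δ → m % d ≡ o % d
    to d∣δ = begin
      m % d         ≡⟨ %-remove-+ʳ m d∣n ⟨
      (m + n) % d   ≡⟨ cong (_% d) δ+o≡m+n ⟨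
      (δ + o) % d   ≡⟨ %-remove-+ˡ o d∣δ ⟩
      o % d         ∎
    from : m % d ≡ o % d → d ∣ δ
    from eq = [m+n]%d≡n%d⇒d∣m δ o (begin
      (δ + o) % d   ≡⟨ cong (_% d) δ+o≡m+n ⟩
      (m + n) % d   ≡⟨ %-remove-+ʳ m d∣n ⟩
      m % d         ≡⟨ eq ⟩
      o % d         ∎)

prime≢1 : ∀ {q} → Prime q → q ≢ 1
prime≢1 pr = nonTrivial⇒≢1 {{prime⇒nonTrivial pr}}

prime∤1 : ∀ {q} → Prime q → ¬ q ∣ 1
prime∤1 pr q∣1 = prime≢1 pr (∣1⇒≡1 q∣1)

∣prodFin : ∀ {t} (f : Fin t → ℕ) i → f i ∣ prodFin f
∣prodFin f zero = m∣m*n _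
∣prodFin f (suc i) = ∣n⇒∣m*n (f zero) (∣prodFin (λ j → f (suc j)) i)

prime∣prodFin⇒∣factor : ∀ {t q} (f : Fin t → ℕ) → Prime q → q ∣ prodFin f → ∃[ i ] q ∣ f i
prime∣prodFin⇒∣factor {zero} f pr q∣1 = contradiction q∣1 (prime∤1 pr)
prime∣prodFin⇒∣factor {suc t} f pr q∣f₀*rest with euclidsLemma (f zero) _ pr q∣f₀*rest
... | inj₁ q∣f₀ = zero , q∣f₀
... | inj₂ q∣rest with prime∣prodFin⇒∣factor (λ i → f (suc i)) pr q∣rest
...   | i , q∣fᵢ = suc i , q∣fᵢ

coprime-* : ∀ {a b c} → Coprime a b → Coprime a c → Coprime a (b * c)
coprime-* {b = b} a⊥b a⊥c {e} (e∣a , e∣bc) = a⊥c (e∣a , coprime-divisor e⊥b e∣bc)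
  where
  e⊥b : Coprime e b
  e⊥b (f∣e , f∣b) = a⊥b (∣-trans f∣e e∣a , f∣b)

coprime-1 : ∀ {a} → Coprime a 1
coprime-1 (_ , e∣1) = ∣1⇒≡1 e∣1

coprime-^ : ∀ {a b} → Coprime a b → ∀ k → Coprime a (b ^ k)
coprime-^ a⊥b zero = coprime-1
coprime-^ a⊥b (suc k) = coprime-* a⊥b (coprime-^ a⊥b k)

coprime-prodFin : ∀ {t a} (f : Fin t → ℕ) → (∀ i → Coprime a (f i)) → Coprime a (prodFin f)
coprime-prodFin {zero} f a⊥f = coprime-1
coprime-prodFin {suc t} f a⊥f =
  coprime-* (a⊥f zero) (coprime-prodFin (λ i → f (suc i)) (λ i → a⊥f (suc i)))

prime∤⇒coprime : ∀ {q a} → Prime q → ¬ q ∣ a → Coprime a q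
prime∤⇒coprime pr q∤a (e∣a , e∣q) with prime⇒irreducible pr e∣q
... | inj₁ e≡1 = e≡1
... | inj₂ refl = contradiction e∣a q∤a

prime∤k*a+b : ∀ {q a b} k → Prime q → ¬ q ∣ k → (q ∣ b ⇔ (¬ q ∣ a)) → ¬ q ∣ k * a + b
prime∤k*a+b {q} {a} {b} k pr q∤k q∣b⇔q∤a q∣ka+b with q ∣? a
... | yes q∣a = Equivalence.to q∣b⇔q∤a (∣m+n∣m⇒∣n q∣ka+b (∣n⇒∣m*n k q∣a)) q∣a
... | no q∤a with euclidsLemma k a pr
                    (∣m+n∣m⇒∣n (subst (q ∣_) (+-comm (k * a) b) q∣ka+b) (Equivalence.from q∣b⇔q∤a q∤a))
...   | inj₁ q∣k = q∤k q∣k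
...   | inj₂ q∣a = q∤a q∣a

module _ {t} (p : Fin t → ℕ) (prime : ∀ i → Prime (p i)) (p-injective : Injective _≡_ _≡_ p) where

  complementFactor : ℕ → Fin t → ℕ
  complementFactor a i with p i ∣? a
  ... | yes _ = 1
  ... | no _ = p i

  complement : ℕ → ℕ
  complement a = prodFin (complementFactor a)

  ∣complement⇔∤ : ∀ a i → p i ∣ complement a ⇔ (¬ p i ∣ a)
  ∣complement⇔∤ a i = mk⇔ to from
    where
    to : p i ∣ complement a → ¬ p i ∣ a
    to pᵢ∣c with prime∣prodFin⇒∣factor (complementFactor a) (prime i) pᵢ∣c
    ... | j , pᵢ∣fⱼ with p j ∣? a
    ...   | yes _ = contradiction pᵢ∣fⱼ (prime∤1 (prime i))
    ...   | no pⱼ∤a with prime⇒irreducible (prime j) pᵢ∣fⱼ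
    ...     | inj₁ pᵢ≡1 = contradiction pᵢ≡1 (prime≢1 (prime i))
    ...     | inj₂ pᵢ≡pⱼ rewrite p-injective pᵢ≡pⱼ = pⱼ∤a
    from : ¬ p i ∣ a → p i ∣ complement a
    from pᵢ∤a = subst (_∣ complement a) factorᵢ≡pᵢ (∣prodFin (complementFactor a) i)
      where
      factorᵢ≡pᵢ : complementFactor a i ≡ p i
      factorᵢ≡pᵢ with p i ∣? a
      ... | yes pᵢ∣a = contradiction pᵢ∣a pᵢ∤a
      ... | no _ = refl

CommonNeighbours : ℕ → Set
CommonNeighbours n = ∀ (x y : Fin n) → ∃[ w ] Adj n x w × Adj n w y

module _ {n : ℕ} where

  ¬adjacent⇒distGE2 : ∀ {u v : Fin n} → u ≢ v → ¬ Adj n u v → DistGE n u v 2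
  ¬adjacent⇒distGE2 u≢v _ zero _ here = u≢v refl
  ¬adjacent⇒distGE2 _ ¬adj 1 _ (step adj here) = ¬adj adj
  ¬adjacent⇒distGE2 _ _ (suc (suc _)) (s≤s (s≤s ())) _

  independent∧singletons⇒packing : ∀ {k} (c : Fin n → Fin (suc k)) →
    (∀ j → ∃[ x ] c x ≡ j) →
    (∀ {u v} → u ≢ v → c u ≡ zero → c v ≡ zero → ¬ Adj n u v) →
    (∀ {u v j} → c u ≡ suc j → c v ≡ suc j → u ≡ v) →
    IsPackingColoring n (suc k) c
  independent∧singletons⇒packing c surjective independent singleton = surjective , packing
    where
    packing : ∀ u v → u ≢ v → c u ≡ c v → DistGE n u v (suc (suc (toℕ (c u))))
    packing u v u≢v cu≡cv with c u in cu
    ... | zero = ¬adjacent⇒distGE2 u≢v (independent u≢v cu (sym cu≡cv))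
    ... | suc j = contradiction (singleton cu (sym cu≡cv)) u≢v

  module _ {k} {c : Fin n → Fin (suc k)} (isPacking : IsPackingColoring n (suc k) c) where
    sameColour⇒¬adjacent : ∀ {u v} → u ≢ v → c u ≡ c v → ¬ Adj n u v
    sameColour⇒¬adjacent {u} {v} u≢v cu≡cv adj =
      proj₂ isPacking u v u≢v cu≡cv 1 (s≤s (s≤s z≤n)) (step adj here)

    sameColour⇒≡ : CommonNeighbours n → ∀ {u v j} → c u ≡ suc j → c v ≡ suc j → u ≡ v
    sameColour⇒≡ common {u} {v} cu≡ cv≡ with u ≟ v
    ... | yes u≡v = u≡v
    ... | no u≢v with common u v
    ...   | w , uw , wv = ⊥-elim (farApart 2 3≤2+cu (step {y = w} uw (step wv here)))
      where
      farApart : DistGE n u v (suc (suc (toℕ (c u))))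
      farApart = proj₂ isPacking u v u≢v (trans cu≡ (sym cv≡))
      3≤2+cu : 3 ≤ suc (suc (toℕ (c u)))
      3≤2+cu rewrite cu≡ = s≤s (s≤s (s≤s z≤n))

  packing⇒n≤q+k : ∀ {q k} → CommonNeighbours n → (block : Fin n → Fin q) →
    (∀ {u v} → block u ≡ block v → u ≢ v → Adj n u v) →
    HasPackingColoring n (suc k) → n ≤ q + k
  packing⇒n≤q+k {q} {k} common block sameBlock⇒adjacent (c , isPacking) =
    injective⇒≤ {f = join q k ∘ classify} (classify-injective ∘ join-injective)
    where
    classify : Fin n → Fin q ⊎ Fin k
    classify x with c x
    ... | zero = inj₁ (block x)
    ... | suc j = inj₂ j

    join-injective : ∀ {x y} → join q k (classify x) ≡ join q k (classify y) → classify x ≡ classify y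
    join-injective {x} {y} eq =
      trans (sym (splitAt-join q k (classify x))) (trans (cong (splitAt q) eq) (splitAt-join q k (classify y)))

    classify-injective : ∀ {x y} → classify x ≡ classify y → x ≡ y
    classify-injective {x} {y} eq with x ≟ y
    ... | yes x≡y = x≡y
    ... | no x≢y with c x in cx | c y in cy
    ...   | zero | zero = ⊥-elim (sameColour⇒¬adjacent isPacking x≢y (trans cx (sym cy))
                                  (sameBlock⇒adjacent (inj₁-injective eq) x≢y))
    ...   | suc i | suc j = sameColour⇒≡ isPacking common cx (trans cy (cong suc (sym (inj₂-injective eq))))

prodFin-nonZero : ∀ {t} (f : Fin t → ℕ) → (∀ i → NonZero (f i)) → NonZero (prodFin f)
prodFin-nonZero {zero} f _ = _
prodFin-nonZero {suc t} f nonZero =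
  m*n≢0 _ _ {{nonZero zero}} {{prodFin-nonZero (λ i → f (suc i)) (λ i → nonZero (suc i))}}

m∣m^n : ∀ m {n} → 1 ≤ n → m ∣ m ^ n
m∣m^n m {suc n} _ = m∣m*n (m ^ n)

module UnitaryCayley (m : ℕ) {t} (p r : Fin t → ℕ) (prime : ∀ i → Prime (p i))
  (r≥1 : ∀ i → 1 ≤ r i) (n≡ : suc m ≡ prodFin (λ i → p i ^ r i)) where

  n : ℕ
  n = suc m

  instance
    p-nonZero : ∀ {i} → NonZero (p i)
    p-nonZero {i} = prime⇒nonZero (prime i)

  p∣n : ∀ i → p i ∣ n
  p∣n i = subst (p i ∣_) (sym n≡) (∣-trans (m∣m^n (p i) (r≥1 i)) (∣prodFin (λ j → p j ^ r j) i))

  adjacent⇔incongruent : ∀ (x y : Fin n) → Adj n x y ⇔ (∀ i → toℕ x % p i ≢ toℕ y % p i)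
  adjacent⇔incongruent x y = mk⇔ to from
    where
    δ : ℕ
    δ = toℕ x + (n ∸ toℕ y)
    p∣δ⇔x≡y : ∀ i → p i ∣ δ ⇔ toℕ x % p i ≡ toℕ y % p i
    p∣δ⇔x≡y i = d∣m+[n∸o]⇔m%d≡o%d (p∣n i) (<⇒≤ (toℕ<n y))
    to : Adj n x y → ∀ i → toℕ x % p i ≢ toℕ y % p i
    to adj i x≡y =
      prime≢1 (prime i) (adj (%-presˡ-∣ (Equivalence.from (p∣δ⇔x≡y i) x≡y) (p∣n i) , p∣n i))
    from : (∀ i → toℕ x % p i ≢ toℕ y % p i) → Adj n x y
    from x≢y = subst (Coprime (δ % n)) (sym n≡)
      (coprime-prodFin (λ i → p i ^ r i) (λ i → coprime-^ (prime∤⇒coprime (prime i) (p∤δ%n i)) (r i)))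
      where
      p∤δ%n : ∀ i → ¬ p i ∣ δ % n
      p∤δ%n i p∣δ%n = x≢y i (Equivalence.to (p∣δ⇔x≡y i) (∣n∣m%n⇒∣m (p∣n i) p∣δ%n))

  -- With δ ≡ x − y and μ the product of the p i not dividing δ, take w ≡ x + δ + μ: then
  -- w − x ≡ δ + μ and w − y ≡ 2δ + μ, and neither is divisible by any p i, since each p i
  -- divides exactly one of δ and μ and p i ∤ 2.
  commonNeighbours : (∀ i → ¬ p i ∣ 2) → Injective _≡_ _≡_ p → CommonNeighbours n
  commonNeighbours p∤2 p-injective x y = w , x~w , w~y
    where
    X Y δ μ W : ℕ
    X = toℕ x
    Y = toℕ y
    δ = X + (n ∸ Y)
    μ = complement p prime p-injective δ
    W = (δ + μ) + X

    w : Fin n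
    w = fromℕ< (m%n<n W n)

    w≡W : ∀ i → toℕ w % p i ≡ W % p i
    w≡W i = trans (cong (_% p i) (toℕ-fromℕ< _)) (m∣n⇒o%n%m≡o%m (p i) n W (p∣n i))

    p∤δ+μ : ∀ i → ¬ p i ∣ δ + μ
    p∤δ+μ i = subst (λ z → ¬ p i ∣ z + μ) (*-identityˡ δ)
      (prime∤k*a+b 1 (prime i) (prime∤1 (prime i)) (∣complement⇔∤ p prime p-injective δ i))

    p∤δ+[δ+μ] : ∀ i → ¬ p i ∣ δ + (δ + μ)
    p∤δ+[δ+μ] i = subst (λ z → ¬ p i ∣ z) 2δ+μ≡
      (prime∤k*a+b 2 (prime i) (p∤2 i) (∣complement⇔∤ p prime p-injective δ i))
      where
      2δ+μ≡ : 2 * δ + μ ≡ δ + (δ + μ)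
      2δ+μ≡ = trans (cong (λ z → δ + z + μ) (+-identityʳ δ)) (+-assoc δ δ μ)

    δ+Y≡X+n : δ + Y ≡ X + n
    δ+Y≡X+n = trans (+-assoc X (n ∸ Y) Y) (cong (X +_) (m∸n+n≡m (<⇒≤ (toℕ<n y))))

    x~w : Adj n x w
    x~w = Equivalence.from (adjacent⇔incongruent x w)
      (λ i X≡w → p∤δ+μ i ([m+n]%d≡n%d⇒d∣m (δ + μ) X (trans (sym (w≡W i)) (sym X≡w))))

    w~y : Adj n w y
    w~y = Equivalence.from (adjacent⇔incongruent w y) (λ i w≡Y → p∤δ+[δ+μ] i
      ([m+n]%d≡n%d⇒d∣m (δ + (δ + μ)) Y (begin
        (δ + (δ + μ) + Y) % p i   ≡⟨ cong (λ z → (z + Y) % p i) (+-comm δ (δ + μ)) ⟩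
        (δ + μ + δ + Y) % p i     ≡⟨ cong (_% p i) (+-assoc (δ + μ) δ Y) ⟩
        (δ + μ + (δ + Y)) % p i   ≡⟨ cong (λ z → (δ + μ + z) % p i) δ+Y≡X+n ⟩
        (δ + μ + (X + n)) % p i   ≡⟨ cong (_% p i) (+-assoc (δ + μ) X n) ⟨
        (W + n) % p i             ≡⟨ %-remove-+ʳ W (p∣n i) ⟩
        W % p i                   ≡⟨ w≡W i ⟨
        toℕ w % p i               ≡⟨ w≡Y ⟩
        Y % p i                   ∎)))
      where open ≡-Reasoning

  -- P = suc d = p i₀ is the least prime, and vertex x = P * b + o has block b < q and offset o < P.
  module Blocks (q d : ℕ) (n≡q*P : n ≡ q * suc d) (i₀ : Fin t) (pᵢ₀≡P : p i₀ ≡ suc d)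
    (P≤p : ∀ i → suc d ≤ p i) where

    position : Fin n → Fin q × Fin (suc d)
    position x = remQuot {q} (suc d) (cast n≡q*P x)

    block : Fin n → Fin q
    block = proj₁ ∘ position

    offset : Fin n → Fin (suc d)
    offset = proj₂ ∘ position

    toℕ-position : ∀ x → toℕ x ≡ suc d * toℕ (block x) + toℕ (offset x)
    toℕ-position x = begin
      toℕ x                                ≡⟨ toℕ-cast n≡q*P x ⟨
      toℕ (cast n≡q*P x)                   ≡⟨ cong toℕ (combine-remQuot {q} (suc d) (cast n≡q*P x)) ⟨
      toℕ (uncurry combine (position x))   ≡⟨ toℕ-combine (block x) (offset x) ⟩
      suc d * toℕ (block x) + toℕ (offset x)  ∎
      where open ≡-Reasoning

    position-injective : ∀ {x y} → position x ≡ position y → x ≡ y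
    position-injective {x} {y} eq = toℕ-injective (begin
      toℕ x                                                          ≡⟨ toℕ-position x ⟩
      suc d * toℕ (block x) + toℕ (offset x)    ≡⟨ cong (λ (b , o) → suc d * toℕ b + toℕ o) eq ⟩
      suc d * toℕ (block y) + toℕ (offset y)    ≡⟨ toℕ-position y ⟨
      toℕ y                                                          ∎)
      where open ≡-Reasoning

    position-surjective : ∀ bo → ∃[ x ] position x ≡ bo
    position-surjective (b , o) = cast (sym n≡q*P) (combine b o) ,
      trans (cong (remQuot {q} (suc d)) (cast-involutive n≡q*P (sym n≡q*P) (combine b o))) (remQuot-combine b o)

    sameBlock⇒adjacent : ∀ {x y} → block x ≡ block y → x ≢ y → Adj n x y
    sameBlock⇒adjacent {x} {y} bx≡by x≢y = Equivalence.from (adjacent⇔incongruent x y) λ i x≡y →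
      x≢y (position-injective (cong₂ _,_ bx≡by (toℕ-injective (offsets≡ i x≡y))))
      where
      open ≡-Reasoning
      b oˣ oʸ : ℕ
      b = toℕ (block y)
      oˣ = toℕ (offset x)
      oʸ = toℕ (offset y)
      o<p : ∀ i (o : Fin (suc d)) → toℕ o < p i
      o<p i o = ≤-trans (toℕ<n o) (P≤p i)
      offsets≡ : ∀ i → toℕ x % p i ≡ toℕ y % p i → oˣ ≡ oʸ
      offsets≡ i x≡y = [m+n]%d≡[m+o]%d⇒n≡o (suc d * b) (o<p i (offset x)) (o<p i (offset y)) (begin
        (suc d * b + oˣ) % p i               ≡⟨ cong (λ z → (suc d * toℕ z + oˣ) % p i) bx≡by ⟨
        (suc d * toℕ (block x) + oˣ) % p i   ≡⟨ cong (_% p i) (toℕ-position x) ⟨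
        toℕ x % p i                          ≡⟨ x≡y ⟩
        toℕ y % p i                          ≡⟨ cong (_% p i) (toℕ-position y) ⟩
        (suc d * b + oʸ) % p i               ∎)

    offset≡0⇒pᵢ₀∣ : ∀ {x} → offset x ≡ zero → p i₀ ∣ toℕ x
    offset≡0⇒pᵢ₀∣ {x} o≡0 = subst₂ _∣_ (sym pᵢ₀≡P) (sym x≡) (∣m⇒∣m*n _ ∣-refl)
      where
      x≡ : toℕ x ≡ suc d * toℕ (block x)
      x≡ = trans (toℕ-position x) (trans (cong (λ o → suc d * toℕ (block x) + toℕ o) o≡0) (+-identityʳ _))

    offset≡0⇒¬adjacent : ∀ {x y} → offset x ≡ zero → offset y ≡ zero → ¬ Adj n x y
    offset≡0⇒¬adjacent {x} {y} ox≡0 oy≡0 adj = Equivalence.to (adjacent⇔incongruent x y) adj i₀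
      (trans (n∣m⇒m%n≡0 _ _ (offset≡0⇒pᵢ₀∣ ox≡0))
             (sym (n∣m⇒m%n≡0 _ _ (offset≡0⇒pᵢ₀∣ oy≡0))))

    -- The multiples of P form the first colour class; every other vertex has a colour of its own.
    colourOf : Fin q × Fin (suc d) → Fin (suc (q * d))
    colourOf (_ , zero) = zero
    colourOf (b , suc j) = suc (combine b j)

    colourOf-surjective : Fin q → ∀ c → ∃[ bo ] colourOf bo ≡ c
    colourOf-surjective b zero = (b , zero) , refl
    colourOf-surjective _ (suc c) =
      (proj₁ (remQuot {q} d c) , suc (proj₂ (remQuot {q} d c))) , cong suc (combine-remQuot {q} d c)

    colourOf≡zero : ∀ bo → colourOf bo ≡ zero → proj₂ bo ≡ zero
    colourOf≡zero (_ , zero) _ = refl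

    colourOf≡suc-injective : ∀ bo bo′ {c} → colourOf bo ≡ suc c → colourOf bo′ ≡ suc c → bo ≡ bo′
    colourOf≡suc-injective (b , suc j) (b′ , suc j′) refl eq
      with refl ← trans (sym (remQuot-combine b j))
                        (trans (cong (remQuot {q} d) (suc-injectiveᶠ (sym eq))) (remQuot-combine b′ j′))
      = refl

    colouring : HasPackingColoring n (suc (q * d))
    colouring = colourOf ∘ position , independent∧singletons⇒packing (colourOf ∘ position) surjective
      (λ _ cu≡0 cv≡0 → offset≡0⇒¬adjacent (colourOf≡zero _ cu≡0) (colourOf≡zero _ cv≡0))
      (λ cu≡ cv≡ → position-injective (colourOf≡suc-injective _ _ cu≡ cv≡))
      where
      surjective : ∀ c → ∃[ x ] colourOf (position x) ≡ c
      surjective c with colourOf-surjective (block zero) c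
      ... | bo , bo↦c with position-surjective bo
      ...   | x , x↦bo = x , trans (cong colourOf x↦bo) bo↦c

    packingChromaticNumber : CommonNeighbours n → IsPackingChromaticNumber n (suc (q * d))
    packingChromaticNumber common = colouring , minimal
      where
      minimal : ∀ k → HasPackingColoring n k → suc (q * d) ≤ k
      minimal zero (c , _) with c zero
      ... | ()
      minimal (suc k) packing = s≤s (+-cancelˡ-≤ q (q * d) k (begin
        q + q * d   ≡⟨ *-suc q d ⟨
        q * suc d   ≡⟨ n≡q*P ⟨
        n           ≤⟨ packing⇒n≤q+k common block sameBlock⇒adjacent packing ⟩
        q + k       ∎))
        where open ≤-Reasoning

strictlyIncreasing⇒injective : ∀ {t} {f : Fin t → ℕ} → (∀ i j → i <ᶠ j → f i < f j) →
                               Injective _≡_ _≡_ f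
strictlyIncreasing⇒injective increasing {i} {j} fi≡fj with <ᶠ-cmp i j
... | tri< i<j _ _ = contradiction fi≡fj (<⇒≢ (increasing i j i<j))
... | tri≈ _ i≡j _ = i≡j
... | tri> _ _ j<i = contradiction (sym fi≡fj) (<⇒≢ (increasing j i j<i))

strictlyIncreasing⇒minimum : ∀ {t} {f : Fin (suc t) → ℕ} → (∀ i j → i <ᶠ j → f i < f j) →
                             ∀ i → f zero ≤ f i
strictlyIncreasing⇒minimum increasing zero = ≤-refl
strictlyIncreasing⇒minimum increasing (suc i) = <⇒≤ (increasing zero (suc i) (s≤s z≤n))

^-peelʳ : ∀ a {k} b → 1 ≤ k → a ^ k * b ≡ a ^ (k ∸ 1) * b * a
^-peelʳ a {suc k} b _ = begin
  a * a ^ k * b       ≡⟨ cong (_* b) (*-comm a (a ^ k)) ⟩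
  a ^ k * a * b       ≡⟨ *-assoc (a ^ k) a b ⟩
  a ^ k * (a * b)     ≡⟨ cong (a ^ k *_) (*-comm a b) ⟩
  a ^ k * (b * a)     ≡⟨ *-assoc (a ^ k) b a ⟨
  a ^ k * b * a       ∎
  where open ≡-Reasoning

theorem2p6 : (n s : ℕ) (p r : Fin (suc (suc s)) → ℕ) →
    (∀ i → Prime (p i)) →
    (∀ i j → i <ᶠ j → p i < p j) →
    3 ≤ p zero →
    (∀ i → 1 ≤ r i) →
    n ≡ prodFin (λ i → p i ^ r i) →
    IsPackingChromaticNumber n
      (p zero ^ (r zero ∸ 1) * prodFin (λ i → p (suc i) ^ r (suc i)) * (p zero ∸ 1) + 1)
theorem2p6 zero s p r prime _ _ _ 0≡ =
  ⊥-elim (≢-nonZero⁻¹ _ {{prodFin-nonZero _ p^r≢0}} (sym 0≡))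
  where
  p^r≢0 : ∀ i → NonZero (p i ^ r i)
  p^r≢0 i = m^n≢0 (p i) (r i) {{prime⇒nonZero (prime i)}}
theorem2p6 (suc m) s p r prime increasing 3≤p₀ r≥1 n≡ =
  subst (IsPackingChromaticNumber (suc m)) (+-comm 1 (q * d))
    (packingChromaticNumber (commonNeighbours p∤2 (strictlyIncreasing⇒injective increasing)))
  where
  q d : ℕ
  q = p zero ^ (r zero ∸ 1) * prodFin (λ i → p (suc i) ^ r (suc i))
  d = p zero ∸ 1
  1+d≡p₀ : suc d ≡ p zero
  1+d≡p₀ = m+[n∸m]≡n (≤-trans (s≤s z≤n) 3≤p₀)
  n≡q*P : suc m ≡ q * suc d
  n≡q*P = trans n≡ (trans (^-peelʳ (p zero) _ (r≥1 zero)) (cong (q *_) (sym 1+d≡p₀)))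
  open UnitaryCayley m p r prime r≥1 n≡
  p₀≤ : ∀ i → p zero ≤ p i
  p₀≤ = strictlyIncreasing⇒minimum increasing
  open Blocks q d n≡q*P zero (sym 1+d≡p₀) (λ i → subst (_≤ p i) (sym 1+d≡p₀) (p₀≤ i))
  p∤2 : ∀ i → ¬ p i ∣ 2
  p∤2 i pᵢ∣2 = <⇒≱ (≤-trans 3≤p₀ (p₀≤ i)) (∣⇒≤ pᵢ∣2)
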